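{- Let $\mathfrak{F}=(X,\upharpoonleft,Y,T)$ be a Heyting frame. Then for any Galois stable sets $A,C\subseteq X$ and any $x\in X$: $x\in(A\Rightarrow C)$ iff for all $z\in X$, if $x\leq z$ then ($z\in A$ implies $z\in C$).
   Context: A sorted frame (polarity) is $(X,\upharpoonleft,Y)$ with $X,Y$ nonempty and ${\upharpoonleft}\subseteq X\times Y$. For $U\subseteq X$, $V\subseteq Y$: $U^{\perp}=\{y:\forall x\in U\ x\upharpoonleft y\}$, ${}^{\perp}V=\{x:\forall y\in V\ x\upharpoonleft y\}$. Stable sets $A={}^{\perp}(A^{\perp})$; co-stable sets $B=({}^{\perp}B)^{\perp}$; both are Galois sets; for $W\subseteq Y$, $W''=({}^\perp W)^\perp$. Orders: $x\leq z$ iff $\{x\}^\perp\subseteq\{z\}^\perp$ on $X$, $y\leq v$ iff ${}^\perp\{y\}\subseteq{}^\perp\{v\}$ on $Y$; $\Gamma u=\{w:u\leq w\}$. For $T\subseteq Y\times X\times Y$, $T'$ is given by $uT'xv$ iff $\forall y(yTxv\Rightarrow u\upharpoonleft y)$. An implicative frame satisfies: (F0) $x\upharpoonleft y$ iff $uT'xy$ for all $u\in X$; (F1) the orders are partial orders; (F2) each $\{y:yTxv\}$ equals $\Gamma w$ for some $w\in Y$; (F3) $yTxv$, $x_1\leq x$, $v_1\leq v$ imply $yTx_1v_1$; (F4) for all $z,x\in X$, $v\in Y$, the sets $\{x_1:zT'x_1v\}$, $\{v_1:zT'xv_1\}$ are Galois sets. Derived relations: $vR^{\partial11}zx$ iff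 $xT'zv$; $uR^{111}zx$ iff $\forall v(vR^{\partial11}zx\Rightarrow u\upharpoonleft v)$. Upper bound relation: $uR_\leq xz$ iff $x\leq u$ and $z\leq u$. A Heyting frame is an implicative frame in which $\{u:uR^{111}xz\}=\{u:uR_\leq xz\}$ for all $x,z\in X$. For stable $A,C$: $A\Rightarrow C={}^\perp\big((\{y:\exists x\in A\,\exists v\in C^\perp\ yTxv\})''\big)$. -}

module Defs where

open import Level using (Level; suc; _⊔_)
open import Data.Product using (Σ; ∃; _×_; _,_)
open import Function.Bundles using (_⇔_)
open import Relation.Binary.PropositionalEquality using (_≡_)

Pred : {ℓ : Level} → Set ℓ → Set (suc ℓ)
Pred {ℓ} S = S → Set ℓ

_⊆_ : {ℓ : Level} {S : Set ℓ} → Pred S → Pred S → Set ℓ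
P ⊆ Q = ∀ s → P s → Q s

_≐_ : {ℓ : Level} {S : Set ℓ} → Pred S → Pred S → Set ℓ
P ≐ Q = (P ⊆ Q) × (Q ⊆ P)

record SortedFrameT (ℓ : Level) : Set (suc ℓ) where
  field
    X    : Set ℓ
    Y    : Set ℓ
    x₀   : X
    y₀   : Y
    _↿_  : X → Y → Set ℓ
    T    : Y → X → Y → Set ℓ

  _⊥ : Pred X → Pred Y
  (U ⊥) y = ∀ x → U x → x ↿ y

  ⊥_ : Pred Y → Pred X
  (⊥ V) x = ∀ y → V y → x ↿ y

  Stable : Pred X → Set ℓ
  Stable A = A ≐ (⊥ (A ⊥))

  CoStable : Pred Y → Set ℓ
  CoStable B = B ≐ ((⊥ B) ⊥)

  _″ : Pred Y → Pred Y
  W ″ = (⊥ W) ⊥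

  _≤X_ : X → X → Set ℓ
  x ≤X z = ∀ y → x ↿ y → z ↿ y

  _≤Y_ : Y → Y → Set ℓ
  y ≤Y v = ∀ x → x ↿ y → x ↿ v

  ΓY : Y → Pred Y
  ΓY w v = w ≤Y v

  T′ : X → X → Y → Set ℓ
  T′ u x v = ∀ y → T y x v → u ↿ y

  R∂11 : Y → X → X → Set ℓ
  R∂11 v z x = T′ x z v

  R111 : X → X → X → Set ℓ
  R111 u z x = ∀ v → R∂11 v z x → u ↿ v

  R≤ : X → X → X → Set ℓ
  R≤ u x z = (x ≤X u) × (z ≤X u)

  ⇒pre : Pred X → Pred X → Pred Y
  ⇒pre A C y = ∃ λ x → ∃ λ v → A x × (C ⊥) v × T y x v

  _⇛_ : Pred X → Pred X → Pred X
  A ⇛ C = ⊥ ((⇒pre A C) ″)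

  PartialOrders : Set ℓ
  PartialOrders =
    (∀ x z → x ≤X z → z ≤X x → x ≡ z) × (∀ y v → y ≤Y v → v ≤Y y → y ≡ v)

record IsImplicative {ℓ : Level} (F : SortedFrameT ℓ) : Set (suc ℓ) where
  open SortedFrameT F
  field
    F0 : ∀ x y → (x ↿ y) ⇔ (∀ u → T′ u x y)
    F1 : PartialOrders
    F2 : (x : X) (v : Y) → ∃ λ w → (λ y → T y x v) ≐ ΓY w
    F3 : ∀ y x v x₁ v₁ → T y x v → x₁ ≤X x → v₁ ≤Y v → T y x₁ v₁
    F4a : (z : X) (v : Y) → Stable (λ x₁ → T′ z x₁ v)
    F4b : (z x : X) → CoStable (λ v₁ → T′ z x v₁)

record IsHeyting {ℓ : Level} (F : SortedFrameT ℓ) : Set (suc ℓ) where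
  open SortedFrameT F
  field
    implicative : IsImplicative F
    heyting     : ∀ x z → (λ u → R111 u x z) ≐ (λ u → R≤ u x z)

-- In any sorted frame, x ∈ A ⇒ C says exactly that x T′ z v for all z ∈ A and
-- v ∈ C⊥. The Heyting condition, together with co-stability of {v | x T′ z v}
-- (F4), identifies that set with the orthogonal of the common upper bounds of
-- z and x. So x ∈ A ⇒ C iff every upper bound u of some z ∈ A and x lies in
-- ⊥(C⊥) = C; since stable sets are upward closed, this is the Kripke clause.
{-# OPTIONS --safe #-}
module Submission where

open import Level using (Level)
open import Function.Bundles using (_⇔_; mk⇔; Equivalence)
open import Data.Product using (_,_; proj₁; proj₂)
open import Defs

module _ {ℓ : Level} (F : SortedFrameT ℓ) where
  open SortedFrameT F

  ≤X-refl : ∀ x → x ≤X x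
  ≤X-refl x y x↿y = x↿y

  ⊥-upwardClosed : (V : Pred Y) {x z : X} → (⊥ V) x → x ≤X z → (⊥ V) z
  ⊥-upwardClosed V x∈⊥V x≤z y y∈V = x≤z y (x∈⊥V y y∈V)

  stable-upwardClosed : {A : Pred X} → Stable A → {x z : X} → A x → x ≤X z → A z
  stable-upwardClosed {A} (A⊆⊥A⊥ , ⊥A⊥⊆A) {x} {z} Ax x≤z =
    ⊥A⊥⊆A z (⊥-upwardClosed (A ⊥) (A⊆⊥A⊥ x Ax) x≤z)

  ⇛⇔T′ : (A C : Pred X) (x : X) →
         (A ⇛ C) x ⇔ (∀ z v → A z → (C ⊥) v → T′ x z v)
  ⇛⇔T′ A C x = mk⇔ to from
    where
    to : (A ⇛ C) x → ∀ z v → A z → (C ⊥) v → T′ x z v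
    to x∈A⇛C z v Az v∈C⊥ y Tyzv =
      x∈A⇛C y (λ x′ x′∈⊥pre → x′∈⊥pre y (z , v , Az , v∈C⊥ , Tyzv))

    from : (∀ z v → A z → (C ⊥) v → T′ x z v) → (A ⇛ C) x
    from h y y∈pre″ = y∈pre″ x λ { y′ (z , v , Az , v∈C⊥ , Ty′zv) →
      h z v Az v∈C⊥ y′ Ty′zv }

module _ {ℓ : Level} {F : SortedFrameT ℓ} (H : IsHeyting F) where
  open SortedFrameT F
  open IsHeyting H
  open IsImplicative implicative

  -- ⊥ {v | x T′ z v} is literally {u | u R111 z x}, and F4 makes {v | x T′ z v} co-stable.
  T′⇔⊥upperBounds : ∀ x z v → T′ x z v ⇔ (∀ u → R≤ u z x → u ↿ v)
  T′⇔⊥upperBounds x z v = mk⇔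
    (λ xT′zv u u≥z,x → proj₂ (heyting z x) u u≥z,x v xT′zv)
    (λ h → proj₂ (F4b x z) v λ u uR111zx → h u (proj₁ (heyting z x) u uR111zx))

proposition3p16 : {ℓ : Level} (F : SortedFrameT ℓ) → IsHeyting F →
    let open SortedFrameT F in
    (A C : Pred X) → Stable A → Stable C → (x : X) →
    (A ⇛ C) x ⇔ (∀ z → x ≤X z → A z → C z)
proposition3p16 F H A C stableA (_ , ⊥C⊥⊆C) x = mk⇔ sound complete
  where
  open SortedFrameT F
  open Equivalence

  sound : (A ⇛ C) x → ∀ z → x ≤X z → A z → C z
  sound x∈A⇛C z x≤z Az = ⊥C⊥⊆C z λ v v∈C⊥ →
    to (T′⇔⊥upperBounds H x z v) (to (⇛⇔T′ F A C x) x∈A⇛C z v Az v∈C⊥)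
       z (≤X-refl F z , x≤z)

  complete : (∀ z → x ≤X z → A z → C z) → (A ⇛ C) x
  complete h = from (⇛⇔T′ F A C x) λ z v Az v∈C⊥ →
    from (T′⇔⊥upperBounds H x z v) λ { u (z≤u , x≤u) →
      v∈C⊥ u (h u x≤u (stable-upwardClosed F stableA Az z≤u)) }
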